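{- Let $\kappa$ be a positive integer and $n=\kappa^2+1$. Let $A$ be an $n\times n$ $(0,1)$-matrix with all row and column sums equal to $\kappa$, and suppose $\Theta^m(A)=A$ for some integer $m\ge1$. Then: (L) $A$ is $J_2$-free; (S) $A$ is symmetric; (Z) all entries on the main diagonal of $A$ are $0$.
   Context: For an $n\times n$ integer matrix $X$ whose row and column sums all equal an integer $\lambda$, define $\Theta(X):=(\lambda-1)I_n+J_n-XX^{\mathrm T}$, where $I_n$ is the identity and $J_n$ the all-one matrix of order $n$. Then $\Theta(X)$ again has all row and column sums equal to a common integer ($n-\lambda^2+\lambda-1$), so $\Theta$ can be iterated; $\Theta^m$ denotes the $m$-fold iterate, each application using the common row/column sum of its argument. A $(0,1)$-matrix is $J_2$-free if it contains no $2\times 2$ all-one submatrix (i.e. no rows $i\ne l$ and columns $j\ne k$ with all four entries $(i,j),(i,k),(l,j),(l,k)$ equal to $1$). -}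

module Defs where

open import Data.Nat using (ℕ; zero; suc)
open import Data.Fin using (Fin; zero; suc)
open import Data.Integer using (ℤ; _+_; _-_; _*_; +_; 0ℤ; 1ℤ)
open import Relation.Binary.PropositionalEquality using (_≡_; _≢_)
open import Data.Product using (_×_)
open import Data.Sum using (_⊎_)
open import Data.Fin using (_≟_)
open import Relation.Nullary using (yes; no)
open import Data.Empty using (⊥)

Matrix : ℕ → Set
Matrix n = Fin n → Fin n → ℤ

∑ : (n : ℕ) → (Fin n → ℤ) → ℤ
∑ zero    f = 0ℤ
∑ (suc n) f = f zero + ∑ n (λ i → f (suc i))

I : (n : ℕ) → Matrix n
I n i j with i ≟ j
... | yes _ = 1ℤ
... | no _  = 0ℤ

J : (n : ℕ) → Matrix n
J n i j = 1ℤ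

XXᵀ : (n : ℕ) → Matrix n → Matrix n
XXᵀ n X i j = ∑ n (λ k → X i k * X j k)

-- Θ(X) = (λ-1) I + J - X Xᵀ, for a matrix with common row/column sum λ
Θ : (n : ℕ) → ℤ → Matrix n → Matrix n
Θ n l X i j = (l - 1ℤ) * I n i j + J n i j - XXᵀ n X i j

-- common row/column sum of Θ(X) when X has common row/column sum λ
ΘSum : ℕ → ℤ → ℤ
ΘSum n l = + n - l * l + l - 1ℤ

-- m-fold iterate Θ^m(X), where X has common row/column sum λ;
-- each application uses the common row/column sum of its argument
Θ^ : (n : ℕ) → ℕ → ℤ → Matrix n → Matrix n
Θ^ n zero    l X = X
Θ^ n (suc m) l X = Θ^ n m (ΘSum n l) (Θ n l X)

Is01 : (n : ℕ) → Matrix n → Set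
Is01 n X = ∀ i j → X i j ≡ 0ℤ ⊎ X i j ≡ 1ℤ

RowColSums : (n : ℕ) → Matrix n → ℤ → Set
RowColSums n X l = (∀ i → ∑ n (λ j → X i j) ≡ l) × (∀ j → ∑ n (λ i → X i j) ≡ l)

J₂-free : (n : ℕ) → Matrix n → Set
J₂-free n X = ∀ i l j k → i ≢ l → j ≢ k →
  X i j ≡ 1ℤ → X i k ≡ 1ℤ → X l j ≡ 1ℤ → X l k ≡ 1ℤ → ⊥

Symmetric : (n : ℕ) → Matrix n → Set
Symmetric n X = ∀ i j → X i j ≡ X j i

ZeroDiagonal : (n : ℕ) → Matrix n → Set
ZeroDiagonal n X = ∀ i → X i i ≡ 0ℤ

_≐_ : {n : ℕ} → Matrix n → Matrix n → Set
X ≐ Y = ∀ i j → X i j ≡ Y i j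

-- Write n = κ² + 1.  Then Θ = Θ(·, κ) maps matrices with all line sums κ to matrices with all
-- line sums κ, so every iterate Θʲ(A) has line sums κ.  For such an X the diagonal entries of
-- Θ(X) are -Σₖ Xᵢₖ(Xᵢₖ - 1) ≤ 0 and the off-diagonal ones are 1 - ⟨row i, row i′⟩.  Hence, if
-- Θ(X) is a (0,1)-matrix, its diagonal vanishes, X is a (0,1)-matrix, and no two rows of X share
-- two ones.  As Θᵐ(A) = A is a (0,1)-matrix this propagates down to Θ(A), giving J₂-freeness of
-- A, while A = Θ(Θᵐ⁻¹(A)) is symmetric with zero diagonal.

module Submission where

open import Defs
open import Data.Nat using (ℕ; suc; _*_; _≥_)
open import Data.Integer using (+_)
open import Relation.Binary.PropositionalEquality using (_≡_)
open import Data.Product using (_×_)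

open import Data.Nat using (zero; z≤n; _≤′_; ≤′-refl; ≤′-step)
open import Data.Nat.Properties using (≤⇒≤′)
open import Data.Integer as ℤ using (ℤ; 0ℤ; 1ℤ; -1ℤ; -[1+_]; _+_; _-_; -_; _≤_; +≤+)
open import Data.Integer.Properties
  using (+-*-semiring; +-identityʳ; *-identityˡ; *-comm; *-zeroʳ; pos-*; -1*i≡-i;
         ≤-refl; ≤-reflexive; ≤-trans; ≤-antisym; +-mono-≤; +-monoʳ-≤; neg-cancel-≤; neg-mono-≤;
         module ≤-Reasoning)
open import Data.Integer.Tactic.RingSolver using (solve-∀)
open import Algebra.Properties.Semiring.Sum +-*-semiring
  using (sum; sum-cong-≗; ∑-distrib-+; ∑-comm; *-distribˡ-sum; *-distribʳ-sum;
         sum-remove; sum-replicate-zero)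
open import Data.Fin using (Fin; zero; suc; _≟_; punchIn; punchOut)
open import Data.Fin.Properties using (punchInᵢ≢i; punchIn-punchOut)
open import Data.Product using (_,_)
open import Data.Sum using (_⊎_; inj₁; inj₂)
open import Data.Empty using (⊥-elim)
open import Function using (_∘_; case_of_)
open import Relation.Binary.PropositionalEquality
  using (refl; sym; trans; cong; cong₂; subst; _≢_; module ≡-Reasoning)
open import Relation.Nullary using (yes; no)

-- Defs' ∑ and the library's sum recurse differently, so they agree only propositionally.
∑≡sum : ∀ n (f : Fin n → ℤ) → ∑ n f ≡ sum f
∑≡sum zero    f = refl
∑≡sum (suc n) f = cong (λ s → f zero + s) (∑≡sum n (f ∘ suc))

sum-ones : ∀ n → sum {n} (λ _ → 1ℤ) ≡ + n
sum-ones zero    = refl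
sum-ones (suc n) = cong (λ s → 1ℤ + s) (sum-ones n)

sum-neg : ∀ {n} (f : Fin n → ℤ) → sum (λ k → - f k) ≡ - sum f
sum-neg f = begin
  sum (λ k → - f k)       ≡⟨ sum-cong-≗ (sym ∘ -1*i≡-i ∘ f) ⟩
  sum (λ k → -1ℤ ℤ.* f k) ≡⟨ sym (*-distribˡ-sum -1ℤ f) ⟩
  -1ℤ ℤ.* sum f           ≡⟨ -1*i≡-i (sum f) ⟩
  - sum f                 ∎
  where open ≡-Reasoning

sum-sub : ∀ {n} (f g : Fin n → ℤ) → sum (λ k → f k - g k) ≡ sum f - sum g
sum-sub f g = trans (∑-distrib-+ f (λ k → - g k)) (cong (λ s → sum f + s) (sum-neg g))

sum-nonneg : ∀ {n} {f : Fin n → ℤ} → (∀ k → 0ℤ ≤ f k) → 0ℤ ≤ sum f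
sum-nonneg {zero}  f≥0 = ≤-refl
sum-nonneg {suc n} f≥0 = +-mono-≤ (f≥0 zero) (sum-nonneg (f≥0 ∘ suc))

term≤sum : ∀ {n} {f : Fin n → ℤ} → (∀ k → 0ℤ ≤ f k) → ∀ j → f j ≤ sum f
term≤sum {suc n} {f} f≥0 j = begin
  f j                        ≡⟨ sym (+-identityʳ (f j)) ⟩
  f j + 0ℤ                   ≤⟨ +-monoʳ-≤ (f j) (sum-nonneg (f≥0 ∘ punchIn j)) ⟩
  f j + sum (f ∘ punchIn j)  ≡⟨ sym (sum-remove f) ⟩
  sum f                      ∎
  where open ≤-Reasoning

two-terms≤sum : ∀ {n} {f : Fin n → ℤ} → (∀ k → 0ℤ ≤ f k) →
                ∀ {j k} → j ≢ k → f j + f k ≤ sum f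
two-terms≤sum {suc n} {f} f≥0 {j} {k} j≢k = begin
  f j + f k                  ≡⟨ cong (λ t → f j + f t) (sym (punchIn-punchOut j≢k)) ⟩
  f j + f (punchIn j k′)     ≤⟨ +-monoʳ-≤ (f j) (term≤sum (f≥0 ∘ punchIn j) k′) ⟩
  f j + sum (f ∘ punchIn j)  ≡⟨ sym (sum-remove f) ⟩
  sum f                      ∎
  where
  open ≤-Reasoning
  k′ : Fin n
  k′ = punchOut j≢k

nonneg-sum≤0⇒≡0 : ∀ {n} {f : Fin n → ℤ} → (∀ k → 0ℤ ≤ f k) → sum f ≤ 0ℤ → ∀ k → f k ≡ 0ℤ
nonneg-sum≤0⇒≡0 f≥0 sum≤0 k = ≤-antisym (≤-trans (term≤sum f≥0 k) sum≤0) (f≥0 k)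

Is01ℤ : ℤ → Set
Is01ℤ x = x ≡ 0ℤ ⊎ x ≡ 1ℤ

Is01ℤ⇒nonneg : ∀ {x} → Is01ℤ x → 0ℤ ≤ x
Is01ℤ⇒nonneg (inj₁ refl) = ≤-refl
Is01ℤ⇒nonneg (inj₂ refl) = +≤+ z≤n

Is01ℤ-* : ∀ {x y} → Is01ℤ x → Is01ℤ y → Is01ℤ (x ℤ.* y)
Is01ℤ-* (inj₁ refl) _ = inj₁ refl
Is01ℤ-* {y = y} (inj₂ refl) y01 = subst Is01ℤ (sym (*-identityˡ y)) y01

x*x-x≡x*[x-1] : ∀ x → x ℤ.* x - x ≡ x ℤ.* (x - 1ℤ)
x*x-x≡x*[x-1] = solve-∀

x*[x-1]-nonneg : ∀ x → 0ℤ ≤ x ℤ.* (x - 1ℤ)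
x*[x-1]-nonneg (+ zero)        = +≤+ z≤n
x*[x-1]-nonneg (+ suc zero)    = +≤+ z≤n
x*[x-1]-nonneg (+ suc (suc k)) = +≤+ z≤n
x*[x-1]-nonneg -[1+ k ]        = +≤+ z≤n

x*[x-1]≡0⇒Is01ℤ : ∀ x → x ℤ.* (x - 1ℤ) ≡ 0ℤ → Is01ℤ x
x*[x-1]≡0⇒Is01ℤ (+ zero)        _ = inj₁ refl
x*[x-1]≡0⇒Is01ℤ (+ suc zero)    _ = inj₂ refl
x*[x-1]≡0⇒Is01ℤ (+ suc (suc k)) ()
x*[x-1]≡0⇒Is01ℤ -[1+ k ]        ()

x*x-x-nonneg : ∀ x → 0ℤ ≤ x ℤ.* x - x
x*x-x-nonneg x = subst (0ℤ ≤_) (sym (x*x-x≡x*[x-1] x)) (x*[x-1]-nonneg x)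

x*x-x≡0⇒Is01ℤ : ∀ x → x ℤ.* x - x ≡ 0ℤ → Is01ℤ x
x*x-x≡0⇒Is01ℤ x eq = x*[x-1]≡0⇒Is01ℤ x (trans (sym (x*x-x≡x*[x-1] x)) eq)

I-diag : ∀ {n} (i : Fin n) → I n i i ≡ 1ℤ
I-diag i with i ≟ i
... | yes _   = refl
... | no i≢i  = ⊥-elim (i≢i refl)

I-off : ∀ {n} {i j : Fin n} → i ≢ j → I n i j ≡ 0ℤ
I-off {i = i} {j} i≢j with i ≟ j
... | yes i≡j = ⊥-elim (i≢j i≡j)
... | no _    = refl

I-symmetric : ∀ n → Symmetric n (I n)
I-symmetric n i j = case i ≟ j of λ where
  (yes refl) → refl
  (no i≢j)   → trans (I-off i≢j) (sym (I-off (i≢j ∘ sym)))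

sum-I-row : ∀ {n} (i : Fin n) → sum (I n i) ≡ 1ℤ
sum-I-row {suc n} i = begin
  sum (I (suc n) i)                             ≡⟨ sum-remove (I (suc n) i) ⟩
  I (suc n) i i + sum (I (suc n) i ∘ punchIn i) ≡⟨ cong₂ _+_ (I-diag i) off-diagonal ⟩
  1ℤ                                            ∎
  where
  open ≡-Reasoning
  off-diagonal : sum (I (suc n) i ∘ punchIn i) ≡ 0ℤ
  off-diagonal = trans (sum-cong-≗ (λ j → I-off (punchInᵢ≢i i j ∘ sym))) (sum-replicate-zero n)

rowSum : ∀ {n X l} → RowColSums n X l → ∀ i → sum (X i) ≡ l
rowSum {n} {X} (rows , _) i = trans (sym (∑≡sum n (X i))) (rows i)

colSum : ∀ {n X l} → RowColSums n X l → ∀ j → sum (λ i → X i j) ≡ l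
colSum {n} {X} (_ , cols) j = trans (sym (∑≡sum n (λ i → X i j))) (cols j)

XXᵀ≡sum : ∀ {n} (X : Matrix n) i j → XXᵀ n X i j ≡ sum (λ k → X i k ℤ.* X j k)
XXᵀ≡sum {n} X i j = ∑≡sum n (λ k → X i k ℤ.* X j k)

XXᵀ-symmetric : ∀ {n} (X : Matrix n) → Symmetric n (XXᵀ n X)
XXᵀ-symmetric X i j = begin
  XXᵀ _ X i j                    ≡⟨ XXᵀ≡sum X i j ⟩
  sum (λ k → X i k ℤ.* X j k)    ≡⟨ sum-cong-≗ (λ k → *-comm (X i k) (X j k)) ⟩
  sum (λ k → X j k ℤ.* X i k)    ≡⟨ sym (XXᵀ≡sum X j i) ⟩
  XXᵀ _ X j i                    ∎
  where open ≡-Reasoning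

XXᵀ-rowSum : ∀ {n X l} → RowColSums n X l → ∀ i → sum (XXᵀ n X i) ≡ l ℤ.* l
XXᵀ-rowSum {n} {X} {l} sums i = begin
  sum (XXᵀ n X i)                              ≡⟨ sum-cong-≗ (XXᵀ≡sum X i) ⟩
  sum (λ j → sum (λ k → X i k ℤ.* X j k))      ≡⟨ ∑-comm (λ j k → X i k ℤ.* X j k) ⟩
  sum (λ k → sum (λ j → X i k ℤ.* X j k))      ≡⟨ sum-cong-≗ (λ k → sym (*-distribˡ-sum (X i k) (λ j → X j k))) ⟩
  sum (λ k → X i k ℤ.* sum (λ j → X j k))      ≡⟨ sum-cong-≗ (λ k → cong (X i k ℤ.*_) (colSum sums k)) ⟩
  sum (λ k → X i k ℤ.* l)                      ≡⟨ sym (*-distribʳ-sum l (X i)) ⟩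
  sum (X i) ℤ.* l                              ≡⟨ cong (ℤ._* l) (rowSum sums i) ⟩
  l ℤ.* l                                      ∎
  where open ≡-Reasoning

Θ-symmetric : ∀ {n} l (X : Matrix n) → Symmetric n (Θ n l X)
Θ-symmetric {n} l X i j =
  cong₂ (λ a b → (l - 1ℤ) ℤ.* a + 1ℤ - b) (I-symmetric n i j) (XXᵀ-symmetric X i j)

Θ-rowSum : ∀ {n X l} → RowColSums n X l → ∀ i → sum (Θ n l X i) ≡ ΘSum n l
Θ-rowSum {n} {X} {l} sums i = begin
  sum (λ j → (l - 1ℤ) ℤ.* I n i j + 1ℤ - XXᵀ n X i j)
    ≡⟨ sum-sub (λ j → (l - 1ℤ) ℤ.* I n i j + 1ℤ) (XXᵀ n X i) ⟩
  sum (λ j → (l - 1ℤ) ℤ.* I n i j + 1ℤ) - sum (XXᵀ n X i)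
    ≡⟨ cong₂ _-_ (∑-distrib-+ (λ j → (l - 1ℤ) ℤ.* I n i j) (λ _ → 1ℤ)) (XXᵀ-rowSum sums i) ⟩
  (sum (λ j → (l - 1ℤ) ℤ.* I n i j) + sum {n} (λ _ → 1ℤ)) - l ℤ.* l
    ≡⟨ cong (λ s → (s + sum {n} (λ _ → 1ℤ)) - l ℤ.* l) (sym (*-distribˡ-sum (l - 1ℤ) (I n i))) ⟩
  ((l - 1ℤ) ℤ.* sum (I n i) + sum {n} (λ _ → 1ℤ)) - l ℤ.* l
    ≡⟨ cong₂ (λ a b → ((l - 1ℤ) ℤ.* a + b) - l ℤ.* l) (sum-I-row i) (sum-ones n) ⟩
  ((l - 1ℤ) ℤ.* 1ℤ + + n) - l ℤ.* l
    ≡⟨ rearrange l (+ n) ⟩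
  ΘSum n l
    ∎
  where
  open ≡-Reasoning
  rearrange : ∀ l m → ((l - 1ℤ) ℤ.* 1ℤ + m) - l ℤ.* l ≡ m - l ℤ.* l + l - 1ℤ
  rearrange = solve-∀

Θ-RowColSums : ∀ {n X l} → RowColSums n X l → RowColSums n (Θ n l X) (ΘSum n l)
Θ-RowColSums {n} {X} {l} sums = rows , cols
  where
  rows : ∀ i → ∑ n (Θ n l X i) ≡ ΘSum n l
  rows i = trans (∑≡sum n (Θ n l X i)) (Θ-rowSum sums i)
  cols : ∀ j → ∑ n (λ i → Θ n l X i j) ≡ ΘSum n l
  cols j = trans (∑≡sum n (λ i → Θ n l X i j))
                 (trans (sum-cong-≗ (λ i → Θ-symmetric l X i j)) (Θ-rowSum sums j))

Θ-diagonal : ∀ {n X l} → RowColSums n X l →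
             ∀ i → Θ n l X i i ≡ - sum (λ k → X i k ℤ.* X i k - X i k)
Θ-diagonal {n} {X} {l} sums i = begin
  (l - 1ℤ) ℤ.* I n i i + 1ℤ - XXᵀ n X i i
    ≡⟨ cong₂ (λ a b → (l - 1ℤ) ℤ.* a + 1ℤ - b) (I-diag i) (XXᵀ≡sum X i i) ⟩
  (l - 1ℤ) ℤ.* 1ℤ + 1ℤ - sum (λ k → X i k ℤ.* X i k)
    ≡⟨ rearrange l _ ⟩
  - (sum (λ k → X i k ℤ.* X i k) - l)
    ≡⟨ cong (λ s → - (sum (λ k → X i k ℤ.* X i k) - s)) (sym (rowSum sums i)) ⟩
  - (sum (λ k → X i k ℤ.* X i k) - sum (X i))
    ≡⟨ cong -_ (sym (sum-sub (λ k → X i k ℤ.* X i k) (X i))) ⟩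
  - sum (λ k → X i k ℤ.* X i k - X i k)
    ∎
  where
  open ≡-Reasoning
  rearrange : ∀ l s → (l - 1ℤ) ℤ.* 1ℤ + 1ℤ - s ≡ - (s - l)
  rearrange = solve-∀

Θ-offDiagonal : ∀ {n} l (X : Matrix n) {i j} → i ≢ j →
                Θ n l X i j ≡ 1ℤ - sum (λ k → X i k ℤ.* X j k)
Θ-offDiagonal l X {i} {j} i≢j =
  trans (cong₂ (λ a b → (l - 1ℤ) ℤ.* a + 1ℤ - b) (I-off i≢j) (XXᵀ≡sum X i j))
        (cong (λ a → a + 1ℤ - sum (λ k → X i k ℤ.* X j k)) (*-zeroʳ (l - 1ℤ)))

Θ-Is01⇒sum[x*x-x]≡0 : ∀ {n X l} → RowColSums n X l → Is01 n (Θ n l X) →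
                     ∀ i → sum (λ k → X i k ℤ.* X i k - X i k) ≡ 0ℤ
Θ-Is01⇒sum[x*x-x]≡0 {X = X} sums Θ01 i = ≤-antisym sum≤0 (sum-nonneg (x*x-x-nonneg ∘ X i))
  where
  sum≤0 : sum (λ k → X i k ℤ.* X i k - X i k) ≤ 0ℤ
  sum≤0 = neg-cancel-≤ (subst (0ℤ ≤_) (Θ-diagonal sums i) (Is01ℤ⇒nonneg (Θ01 i i)))

Θ-Is01⇒Is01 : ∀ {n X l} → RowColSums n X l → Is01 n (Θ n l X) → Is01 n X
Θ-Is01⇒Is01 {X = X} sums Θ01 i k =
  x*x-x≡0⇒Is01ℤ (X i k)
    (nonneg-sum≤0⇒≡0 (x*x-x-nonneg ∘ X i) (≤-reflexive (Θ-Is01⇒sum[x*x-x]≡0 sums Θ01 i)) k)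

Θ-Is01⇒ZeroDiagonal : ∀ {n X l} → RowColSums n X l → Is01 n (Θ n l X) → ZeroDiagonal n (Θ n l X)
Θ-Is01⇒ZeroDiagonal sums Θ01 i = trans (Θ-diagonal sums i) (cong -_ (Θ-Is01⇒sum[x*x-x]≡0 sums Θ01 i))

Θ-Is01⇒J₂-free : ∀ {n} l (X : Matrix n) → Is01 n X → Is01 n (Θ n l X) → J₂-free n X
Θ-Is01⇒J₂-free l X X01 Θ01 i i′ j k i≢i′ j≢k Xij≡1 Xik≡1 Xi′j≡1 Xi′k≡1 = case 0≤-1 of λ ()
  where
  common : Fin _ → ℤ
  common t = X i t ℤ.* X i′ t
  two≤common : + 2 ≤ sum common
  two≤common = subst (_≤ sum common)
    (cong₂ _+_ (cong₂ ℤ._*_ Xij≡1 Xi′j≡1) (cong₂ ℤ._*_ Xik≡1 Xi′k≡1))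
    (two-terms≤sum (λ t → Is01ℤ⇒nonneg (Is01ℤ-* (X01 i t) (X01 i′ t))) j≢k)
  0≤-1 : 0ℤ ≤ -1ℤ
  0≤-1 = ≤-trans (subst (0ℤ ≤_) (Θ-offDiagonal l X i≢i′) (Is01ℤ⇒nonneg (Θ01 i i′)))
                 (+-monoʳ-≤ 1ℤ (neg-mono-≤ two≤common))

ΘSum-fixed : ∀ κ → ΘSum (suc (κ * κ)) (+ κ) ≡ + κ
ΘSum-fixed κ = trans (cong (λ s → 1ℤ + s - + κ ℤ.* + κ + + κ - 1ℤ) (pos-* κ κ)) (cancel (+ κ))
  where
  cancel : ∀ k → 1ℤ + k ℤ.* k - k ℤ.* k + k - 1ℤ ≡ k
  cancel = solve-∀

module _ {n : ℕ} {l : ℤ} (fixed : ΘSum n l ≡ l) where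

  Θ^-suc : ∀ m X → Θ^ n (suc m) l X ≡ Θ n l (Θ^ n m l X)
  Θ^-suc zero    X = refl
  Θ^-suc (suc m) X rewrite fixed = Θ^-suc m (Θ n l X)

  Θ^-RowColSums : ∀ {X} → RowColSums n X l → ∀ m → RowColSums n (Θ^ n m l X) l
  Θ^-RowColSums sums zero    = sums
  Θ^-RowColSums sums (suc m) rewrite fixed =
    Θ^-RowColSums (subst (RowColSums n _) fixed (Θ-RowColSums sums)) m

  Θ^-Is01-downward : ∀ {X j m} → RowColSums n X l → j ≤′ m →
                     Is01 n (Θ^ n m l X) → Is01 n (Θ^ n j l X)
  Θ^-Is01-downward sums ≤′-refl            Θ^X01 = Θ^X01
  Θ^-Is01-downward {X} sums (≤′-step {m} j≤m) Θ^X01 =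
    Θ^-Is01-downward sums j≤m
      (Θ-Is01⇒Is01 (Θ^-RowColSums sums m) (subst (Is01 n) (Θ^-suc m X) Θ^X01))

theorem1p4 : (κ : ℕ) → κ ≥ 1 → (A : Matrix (suc (κ * κ))) →
    Is01 (suc (κ * κ)) A → RowColSums (suc (κ * κ)) A (+ κ) →
    (m : ℕ) → m ≥ 1 → Θ^ (suc (κ * κ)) m (+ κ) A ≐ A →
    J₂-free (suc (κ * κ)) A × Symmetric (suc (κ * κ)) A × ZeroDiagonal (suc (κ * κ)) A
theorem1p4 κ _ A A01 sums (suc m) m≥1 Θ^A≐A =
  Θ-Is01⇒J₂-free (+ κ) A A01 ΘA01 , A-symmetric , A-zeroDiagonal
  where
  fixed : ΘSum (suc (κ * κ)) (+ κ) ≡ + κ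
  fixed = ΘSum-fixed κ
  B : Matrix (suc (κ * κ))
  B = Θ^ _ m (+ κ) A
  ΘB≐A : Θ _ (+ κ) B ≐ A
  ΘB≐A i j = trans (cong (λ M → M i j) (sym (Θ^-suc fixed m A))) (Θ^A≐A i j)
  ΘB01 : Is01 _ (Θ _ (+ κ) B)
  ΘB01 i j = subst Is01ℤ (sym (ΘB≐A i j)) (A01 i j)
  ΘA01 : Is01 _ (Θ _ (+ κ) A)
  ΘA01 = Θ^-Is01-downward fixed {A} sums (≤⇒≤′ m≥1) (subst (Is01 _) (sym (Θ^-suc fixed m A)) ΘB01)
  A-symmetric : Symmetric _ A
  A-symmetric i j = trans (sym (ΘB≐A i j)) (trans (Θ-symmetric (+ κ) B i j) (ΘB≐A j i))
  A-zeroDiagonal : ZeroDiagonal _ A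
  A-zeroDiagonal i =
    trans (sym (ΘB≐A i i)) (Θ-Is01⇒ZeroDiagonal {X = B} (Θ^-RowColSums fixed {A} sums m) ΘB01 i)
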